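{- Let $P$ be a finite poset, $k\ge1$, and $x,y\in P$ incomparable. Then $w_x(w_y(f))=w_y(w_x(f))$ for all $f\in\mathcal{F}_k(P)$.
   Context: $\mathcal{F}_k(P)$ is the set of functions $f:P\to\{0,1,\dots,k\}$ with $x\le_P y\Rightarrow f(x)\ge f(y)$. For $x\in P$, the whirl $w_x:\mathcal{F}_k(P)\to\mathcal{F}_k(P)$ repeatedly adds $1$ modulo $k+1$ to $f(x)$ (other values unchanged) until the result lies in $\mathcal{F}_k(P)$. -}

module Defs where

open import Data.Nat using (ℕ; zero; suc)
open import Data.Nat.DivMod using (_mod_)
open import Data.Fin using (Fin; toℕ; _≟_) renaming (_≤_ to _≤ᶠ_)
open import Data.Fin.Properties using (all?) renaming (_≤?_ to _≤ᶠ?_)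
open import Relation.Binary.Core using (Rel)
open import Relation.Binary.Definitions using (Decidable)
open import Relation.Nullary using (Dec; yes; no; ¬_)
open import Level using (Level)

-- A finite poset P is represented (up to isomorphism) by a carrier Fin n with
-- a decidable partial order _≤P_ (see the statement).

InF : ∀ {ℓ} {n : ℕ} (_≤P_ : Rel (Fin n) ℓ) (k : ℕ) → (Fin n → Fin (suc k)) → Set ℓ
InF {n = n} _≤P_ k f = (a b : Fin n) → a ≤P b → f b ≤ᶠ f a

InF? : ∀ {ℓ} {n : ℕ} (_≤P_ : Rel (Fin n) ℓ) → Decidable _≤P_ → (k : ℕ)
       → (f : Fin n → Fin (suc k)) → Dec (InF _≤P_ k f)
InF? _≤P_ _≤P?_ k f =
  all? λ a → all? λ b → impl (a ≤P? b) (f b ≤ᶠ? f a)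
  where
    impl : ∀ {a b} {A : Set a} {B : Set b} → Dec A → Dec B → Dec (A → B)
    impl _ (yes q) = yes (λ _ → q)
    impl (no ¬p) _ = yes (λ p → Relation.Nullary.contradiction p ¬p)
    impl (yes p) (no ¬q) = no (λ h → ¬q (h p))

incMod : {k : ℕ} → Fin (suc k) → Fin (suc k)
incMod {k} i = suc (toℕ i) mod (suc k)

update : {n k : ℕ} → (Fin n → Fin (suc k)) → Fin n → Fin (suc k) → Fin n → Fin (suc k)
update f x v z with z ≟ x
... | yes _ = v
... | no _  = f z

-- Repeatedly add 1 mod (k+1) to the value at x until the result lies in 𝓕_k(P),
-- with a fuel bound.  (For f ∈ 𝓕_k(P) the process stops after at most k+1
-- steps, since after k+1 steps f itself is reached; fuel k+1 thus suffices.)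
whirlFuel : ∀ {ℓ} {n : ℕ} (_≤P_ : Rel (Fin n) ℓ) → Decidable _≤P_ → (k : ℕ)
            → ℕ → Fin n → (Fin n → Fin (suc k)) → (Fin n → Fin (suc k))
whirlFuel _≤P_ _≤P?_ k zero    x g = g
whirlFuel _≤P_ _≤P?_ k (suc m) x g with InF? _≤P_ _≤P?_ k g′
  where g′ = update g x (incMod (g x))
... | yes _ = update g x (incMod (g x))
... | no _  = whirlFuel _≤P_ _≤P?_ k m x (update g x (incMod (g x)))

whirl : ∀ {ℓ} {n : ℕ} (_≤P_ : Rel (Fin n) ℓ) → Decidable _≤P_ → (k : ℕ)
        → Fin n → (Fin n → Fin (suc k)) → (Fin n → Fin (suc k))
whirl _≤P_ _≤P?_ k x f = whirlFuel _≤P_ _≤P?_ k (suc k) x f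

{-# OPTIONS --safe #-}
-- The whirl w_x only changes the value at x, and the value it lands on depends only on f x
-- and on which values v are admissible at x, i.e. keep f in 𝓕_k(P) when placed at x.
-- Admissibility at x only involves the elements comparable to x, so replacing f y by another
-- admissible value, as w_y does, does not affect it when y is incomparable to x. Hence
-- w_x (w_y f) and w_x f agree at x, symmetrically at y, and elsewhere both sides equal f.
module Submission where

open import Defs
open import Data.Nat using (ℕ; zero; suc; _+_; _%_; _≥_; NonZero)
open import Data.Nat.DivMod using (%-distribˡ-+; m%n%n≡m%n; m<n⇒m%n≡m; [m+n]%n≡m%n)
open import Data.Nat.GeneralisedArithmetic using (iterate)
open import Data.Nat.Properties using (+-identityʳ; +-suc)
open import Data.Fin using (Fin; toℕ; _≟_) renaming (_≤_ to _≤ᶠ_)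
open import Data.Fin.Properties using (toℕ-fromℕ<; toℕ-injective; toℕ<n)
open import Data.Sum using (_⊎_; inj₁; inj₂)
open import Function using (_∘_)
open import Function.Bundles using (_⇔_; mk⇔; Equivalence)
open import Function.Properties.Equivalence using () renaming (sym to ⇔-sym; trans to ⇔-trans)
open import Relation.Binary.Core using (Rel)
open import Relation.Binary.Definitions using (Decidable)
open import Relation.Binary.PropositionalEquality
  using (_≡_; _≗_; refl; sym; trans; cong; subst; subst₂; module ≡-Reasoning)
open import Relation.Binary.Structures using (IsDecPartialOrder)
open import Relation.Nullary using (¬_; Dec; yes; no; contradiction)

module _ {n k : ℕ} where

  private
    Fn : Set
    Fn = Fin n → Fin (suc k)

  update-same : ∀ (g : Fn) x v → update g x v x ≡ v
  update-same g x v with x ≟ x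
  ... | yes _  = refl
  ... | no x≢x = contradiction refl x≢x

  update-other : ∀ (g : Fn) {x} v {z} → ¬ z ≡ x → update g x v z ≡ g z
  update-other g {x} v {z} z≢x with z ≟ x
  ... | yes z≡x = contradiction z≡x z≢x
  ... | no _    = refl

  update-cong : ∀ {g h : Fn} x v → g ≗ h → update g x v ≗ update h x v
  update-cong x v g≗h z with z ≟ x
  ... | yes _ = refl
  ... | no _  = g≗h z

  update-update : ∀ (g : Fn) x u v → update (update g x u) x v ≗ update g x v
  update-update g x u v z with z ≟ x
  ... | yes _   = refl
  ... | no z≢x  = update-other g u z≢x

  update-self : ∀ (g : Fn) x → update g x (g x) ≗ g
  update-self g x z with z ≟ x
  ... | yes refl = refl
  ... | no _     = refl

  update-update-agrees : ∀ (g : Fn) {x y} u v {z} → z ≡ x ⊎ ¬ z ≡ y →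
                         update (update g y u) x v z ≡ update g x v z
  update-update-agrees g {x} u v (inj₁ refl) = trans (update-same _ x v) (sym (update-same g x v))
  update-update-agrees g {x} u v {z} (inj₂ z≢y) with z ≟ x
  ... | yes _ = refl
  ... | no _  = update-other g u z≢y

  ≗-update-at : ∀ {g h : Fn} {x} → (∀ {z} → ¬ z ≡ x → g z ≡ h z) → g ≗ update h x (g x)
  ≗-update-at {g} {h} {x} agree z with z ≟ x
  ... | yes refl = refl
  ... | no z≢x   = agree z≢x

  next-value-cong : ∀ (g h : Fn) x → g x ≡ h x →
                    update g x (incMod (g x)) x ≡ update h x (incMod (h x)) x
  next-value-cong g h x gx≡hx =
    trans (update-same g x _) (trans (cong incMod gx≡hx) (sym (update-same h x _)))

[m%n+o]%n≡[m+o]%n : ∀ m o n .{{_ : NonZero n}} → (m % n + o) % n ≡ (m + o) % n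
[m%n+o]%n≡[m+o]%n m o n = begin
  (m % n + o) % n           ≡⟨ %-distribˡ-+ (m % n) o n ⟩
  (m % n % n + o % n) % n   ≡⟨ cong (λ r → (r + o % n) % n) (m%n%n≡m%n m n) ⟩
  (m % n + o % n) % n       ≡⟨ %-distribˡ-+ m o n ⟨
  (m + o) % n               ∎
  where open ≡-Reasoning

module _ {k : ℕ} where

  toℕ-incMod : ∀ (a : Fin (suc k)) → toℕ (incMod a) ≡ suc (toℕ a) % suc k
  toℕ-incMod a = toℕ-fromℕ< _

  toℕ-iterate-incMod : ∀ (a : Fin (suc k)) j → toℕ (iterate incMod a j) ≡ (toℕ a + j) % suc k
  toℕ-iterate-incMod a zero = begin
    toℕ a                ≡⟨ m<n⇒m%n≡m (toℕ<n a) ⟨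
    toℕ a % suc k        ≡⟨ cong (_% suc k) (+-identityʳ (toℕ a)) ⟨
    (toℕ a + 0) % suc k  ∎
    where open ≡-Reasoning
  toℕ-iterate-incMod a (suc j) = begin
    toℕ (iterate incMod (incMod a) j)      ≡⟨ toℕ-iterate-incMod (incMod a) j ⟩
    (toℕ (incMod a) + j) % suc k           ≡⟨ cong (λ r → (r + j) % suc k) (toℕ-incMod a) ⟩
    (suc (toℕ a) % suc k + j) % suc k      ≡⟨ [m%n+o]%n≡[m+o]%n (suc (toℕ a)) j (suc k) ⟩
    (suc (toℕ a) + j) % suc k              ≡⟨ cong (_% suc k) (+-suc (toℕ a) j) ⟨
    (toℕ a + suc j) % suc k                ∎
    where open ≡-Reasoning

  iterate-incMod-period : ∀ (a : Fin (suc k)) → iterate incMod a (suc k) ≡ a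
  iterate-incMod-period a = toℕ-injective (begin
    toℕ (iterate incMod a (suc k))  ≡⟨ toℕ-iterate-incMod a (suc k) ⟩
    (toℕ a + suc k) % suc k         ≡⟨ [m+n]%n≡m%n (toℕ a) (suc k) ⟩
    toℕ a % suc k                   ≡⟨ m<n⇒m%n≡m (toℕ<n a) ⟩
    toℕ a                           ∎)
    where open ≡-Reasoning

module _ {ℓ} {n : ℕ} (_≤P_ : Rel (Fin n) ℓ) (k : ℕ) where

  private
    Fn : Set
    Fn = Fin n → Fin (suc k)

  antitone-at : ∀ {g h : Fn} {a b} → InF _≤P_ k g →
                g a ≡ h a → g b ≡ h b → a ≤P b → h b ≤ᶠ h a
  antitone-at g∈F ga≡ha gb≡hb a≤b = subst₂ _≤ᶠ_ gb≡hb ga≡ha (g∈F _ _ a≤b)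

  InF-resp-≗ : ∀ {g h : Fn} → g ≗ h → InF _≤P_ k g → InF _≤P_ k h
  InF-resp-≗ g≗h g∈F a b = antitone-at g∈F (g≗h a) (g≗h b)

  Admissible : Fn → Fin n → Fin (suc k) → Set ℓ
  Admissible g x v = InF _≤P_ k (update g x v)

  Admissible-resp-≗ : ∀ {g h} {x v} → g ≗ h → Admissible g x v ⇔ Admissible h x v
  Admissible-resp-≗ {x = x} {v} g≗h =
    mk⇔ (InF-resp-≗ (update-cong x v g≗h)) (InF-resp-≗ (update-cong x v (sym ∘ g≗h)))

  Admissible-update-same : ∀ {g} {x u v} → Admissible (update g x u) x v ⇔ Admissible g x v
  Admissible-update-same {g} {x} {u} {v} =
    mk⇔ (InF-resp-≗ (update-update g x u v)) (InF-resp-≗ (sym ∘ update-update g x u v))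

  Admissible-update-update : ∀ {g x y u v} → ¬ x ≤P y → ¬ y ≤P x →
                             Admissible g x v → Admissible g y u → Admissible (update g y u) x v
  Admissible-update-update {g} {x} {y} {u} {v} x≰y y≰x adm-x adm-y a b a≤b =
    by-cases (a ≟ x) (b ≟ x)
    where
      agrees : ∀ {z} → z ≡ x ⊎ ¬ z ≡ y → update (update g y u) x v z ≡ update g x v z
      agrees = update-update-agrees g u v

      b≢y : a ≡ x → ¬ b ≡ y
      b≢y a≡x b≡y = x≰y (subst₂ _≤P_ a≡x b≡y a≤b)

      a≢y : b ≡ x → ¬ a ≡ y
      a≢y b≡x a≡y = y≰x (subst₂ _≤P_ a≡y b≡x a≤b)

      by-cases : Dec (a ≡ x) → Dec (b ≡ x) →
                 update (update g y u) x v b ≤ᶠ update (update g y u) x v a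
      by-cases (yes a≡x) _         =
        antitone-at adm-x (sym (agrees (inj₁ a≡x))) (sym (agrees (inj₂ (b≢y a≡x)))) a≤b
      by-cases (no _)    (yes b≡x) =
        antitone-at adm-x (sym (agrees (inj₂ (a≢y b≡x)))) (sym (agrees (inj₁ b≡x))) a≤b
      by-cases (no a≢x)  (no b≢x)  =
        antitone-at adm-y (sym (update-other _ v a≢x)) (sym (update-other _ v b≢x)) a≤b

  Admissible-update-incomparable : ∀ {g x y u v} → ¬ x ≤P y → ¬ y ≤P x → InF _≤P_ k g →
                                   Admissible g y u → Admissible (update g y u) x v ⇔ Admissible g x v
  Admissible-update-incomparable {g} {x} {y} {u} {v} x≰y y≰x g∈F adm-y =
    mk⇔ restore (λ adm-x → Admissible-update-update x≰y y≰x adm-x adm-y)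
    where
      undo : update (update g y u) y (g y) ≗ g
      undo z = trans (update-update g y u (g y) z) (update-self g y z)

      restore : Admissible (update g y u) x v → Admissible g x v
      restore adm = InF-resp-≗ (update-cong x v undo)
        (Admissible-update-update x≰y y≰x adm (InF-resp-≗ (sym ∘ undo) g∈F))

  next-Admissible-cong : ∀ {g h x} → g x ≡ h x → (∀ v → Admissible g x v ⇔ Admissible h x v) →
                         Admissible g x (incMod (g x)) ⇔ Admissible h x (incMod (h x))
  next-Admissible-cong {g} {h} {x} gx≡hx adm =
    subst (λ a → Admissible g x (incMod (g x)) ⇔ Admissible h x (incMod a)) gx≡hx (adm (incMod (g x)))

  module _ (_≤P?_ : Decidable _≤P_) where

    private
      fuel : ℕ → Fin n → Fn → Fn
      fuel = whirlFuel _≤P_ _≤P?_ k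

      w : Fin n → Fn → Fn
      w = whirl _≤P_ _≤P?_ k

    whirlFuel-other : ∀ m x (g : Fn) {z} → ¬ z ≡ x → fuel m x g z ≡ g z
    whirlFuel-other zero    x g z≢x = refl
    whirlFuel-other (suc m) x g z≢x with InF? _≤P_ _≤P?_ k (update g x (incMod (g x)))
    ... | yes _ = update-other g _ z≢x
    ... | no _  = trans (whirlFuel-other m x _ z≢x) (update-other g _ z≢x)

    whirlFuel-InF : ∀ m x (g : Fn) → Admissible g x (iterate incMod (g x) (suc m)) →
                    InF _≤P_ k (fuel (suc m) x g)
    whirlFuel-InF m x g adm with InF? _≤P_ _≤P?_ k (update g x (incMod (g x)))
    ... | yes next∈F = next∈F
    whirlFuel-InF zero    x g adm | no next∉F = contradiction adm next∉F
    whirlFuel-InF (suc m) x g adm | no _      =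
      whirlFuel-InF m x (update g x (incMod (g x)))
        (Equivalence.from Admissible-update-same
          (subst (λ a → Admissible g x (iterate incMod a (suc m))) (sym (update-same g x _)) adm))

    whirlFuel-at-cong : ∀ m x {g h : Fn} → g x ≡ h x →
                        (∀ v → Admissible g x v ⇔ Admissible h x v) →
                        fuel m x g x ≡ fuel m x h x
    whirlFuel-at-cong zero    x gx≡hx _ = gx≡hx
    whirlFuel-at-cong (suc m) x {g} {h} gx≡hx adm
      with InF? _≤P_ _≤P?_ k (update g x (incMod (g x)))
         | InF? _≤P_ _≤P?_ k (update h x (incMod (h x)))
    ... | yes _    | yes _    = next-value-cong g h x gx≡hx
    ... | yes g′∈F | no h′∉F  = contradiction (Equivalence.to (next-Admissible-cong gx≡hx adm) g′∈F) h′∉F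
    ... | no g′∉F  | yes h′∈F = contradiction (Equivalence.from (next-Admissible-cong gx≡hx adm) h′∈F) g′∉F
    ... | no _     | no _     = whirlFuel-at-cong m x (next-value-cong g h x gx≡hx) λ v →
      ⇔-trans Admissible-update-same (⇔-trans (adm v) (⇔-sym Admissible-update-same))

    whirl-other : ∀ x (f : Fn) {z} → ¬ z ≡ x → w x f z ≡ f z
    whirl-other = whirlFuel-other (suc k)

    whirl-≗-update : ∀ x (f : Fn) → w x f ≗ update f x (w x f x)
    whirl-≗-update x f = ≗-update-at (whirl-other x f)

    -- the (k + 1)-st candidate is f x itself, which is admissible, so the fuel k + 1 suffices
    whirl-InF : ∀ x {f : Fn} → InF _≤P_ k f → InF _≤P_ k (w x f)
    whirl-InF x {f} f∈F = whirlFuel-InF k x f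
      (subst (Admissible f x) (sym (iterate-incMod-period (f x)))
        (InF-resp-≗ (sym ∘ update-self f x) f∈F))

    whirl-at-incomparable : ∀ {x y} {f : Fn} → ¬ x ≤P y → ¬ y ≤P x → ¬ x ≡ y → InF _≤P_ k f →
                            w x (w y f) x ≡ w x f x
    whirl-at-incomparable {x} {y} {f} x≰y y≰x x≢y f∈F =
      whirlFuel-at-cong (suc k) x (whirl-other y f x≢y) λ v →
        ⇔-trans (Admissible-resp-≗ (whirl-≗-update y f))
                (Admissible-update-incomparable x≰y y≰x f∈F adm-y)
      where
        adm-y : Admissible f y (w y f y)
        adm-y = InF-resp-≗ (whirl-≗-update y f) (whirl-InF y f∈F)

    whirl-comm-incomparable : ∀ {x y} {f : Fn} → ¬ x ≤P y → ¬ y ≤P x → ¬ x ≡ y → InF _≤P_ k f →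
                              w x (w y f) ≗ w y (w x f)
    whirl-comm-incomparable {x} {y} {f} x≰y y≰x x≢y f∈F z with z ≟ x | z ≟ y
    ... | yes refl | _        = trans (whirl-at-incomparable x≰y y≰x x≢y f∈F) (sym (whirl-other y _ x≢y))
    ... | no _     | yes refl = trans (whirl-other x _ (x≢y ∘ sym))
                                      (sym (whirl-at-incomparable y≰x x≰y (x≢y ∘ sym) f∈F))
    ... | no z≢x   | no z≢y   = begin
      w x (w y f) z  ≡⟨ whirl-other x _ z≢x ⟩
      w y f z        ≡⟨ whirl-other y f z≢y ⟩
      f z            ≡⟨ whirl-other x f z≢x ⟨
      w x f z        ≡⟨ whirl-other y _ z≢y ⟨
      w y (w x f) z  ∎
      where open ≡-Reasoning

proposition2p7 : ∀ {ℓ} (n : ℕ) (_≤P_ : Rel (Fin n) ℓ)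
    (isDPO : IsDecPartialOrder _≡_ _≤P_)
    (k : ℕ) → k ≥ 1 →
    (x y : Fin n) → ¬ (x ≤P y) → ¬ (y ≤P x) →
    (f : Fin n → Fin (suc k)) → InF _≤P_ k f →
    ∀ z → whirl _≤P_ (IsDecPartialOrder._≤?_ isDPO) k x (whirl _≤P_ (IsDecPartialOrder._≤?_ isDPO) k y f) z
        ≡ whirl _≤P_ (IsDecPartialOrder._≤?_ isDPO) k y (whirl _≤P_ (IsDecPartialOrder._≤?_ isDPO) k x f) z
proposition2p7 n _≤P_ isDPO k _ x y x≰y y≰x f f∈F =
  whirl-comm-incomparable _≤P_ k _≤?_ x≰y y≰x (x≰y ∘ reflexive) f∈F
  where open IsDecPartialOrder isDPO using (_≤?_; reflexive)
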